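{- Let $t$ be a $\lambda$-term. If $t$ is strongly normalizing for $\beta$-reduction, then $t$ is strongly normalizing for the reduction generated by the four rules $\beta$, $\delta$, $\gamma$ and $assoc$ together.
   Context: $\lambda$-terms are given by the grammar $\mathcal{M} ::= x \mid \lambda x.\mathcal{M} \mid (\mathcal{M}\ \mathcal{M})$, considered up to $\alpha$-conversion, with application associating to the left. The reduction rules (applied to any subterm) are: $\beta$: $(\lambda x.M\ N) \triangleright M[x:=N]$; $\delta$: $(\lambda y.\lambda x.M\ N) \triangleright \lambda x.(\lambda y.M\ N)$, where $x$ is not free in $N$; $\gamma$: $(\lambda x.M\ N\ P) \triangleright (\lambda x.(M\ P)\ N)$, where $x$ is not free in $P$; $assoc$: $(M\ (\lambda x.N\ P)) \triangleright (\lambda x.(M\ N)\ P)$, where $x$ is not free in $M$. A term is strongly normalizing for a reduction if every reduction sequence starting from it is finite. -}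

module Defs where

open import Data.Nat using (ℕ; zero; suc)

data Term : Set where
  var : ℕ → Term
  lam : Term → Term
  app : Term → Term → Term

Ren : Set
Ren = ℕ → ℕ

liftR : Ren → Ren
liftR ρ zero    = zero
liftR ρ (suc n) = suc (ρ n)

rename : Ren → Term → Term
rename ρ (var n)   = var (ρ n)
rename ρ (lam t)   = lam (rename (liftR ρ) t)
rename ρ (app t u) = app (rename ρ t) (rename ρ u)

shift : Term → Term
shift = rename suc

swap01 : Ren
swap01 zero          = suc zero
swap01 (suc zero)    = zero
swap01 (suc (suc n)) = suc (suc n)

Sub : Set
Sub = ℕ → Term

liftS : Sub → Sub
liftS σ zero    = var zero
liftS σ (suc n) = shift (σ n)

subst : Sub → Term → Term
subst σ (var n)   = σ n
subst σ (lam t)   = lam (subst (liftS σ) t)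
subst σ (app t u) = app (subst σ t) (subst σ u)

single : Term → Sub
single N zero    = N
single N (suc n) = var n

_[_] : Term → Term → Term
M [ N ] = subst (single N) M

data _→β_ : Term → Term → Set where
  β     : ∀ {M N} → app (lam M) N →β (M [ N ])
  ξlam  : ∀ {M M'} → M →β M' → lam M →β lam M'
  ξappl : ∀ {M M' N} → M →β M' → app M N →β app M' N
  ξappr : ∀ {M N N'} → N →β N' → app M N →β app M N'

-- Side conditions "x not free in N/P/M" are the variable conventions;
-- in de Bruijn form they are realised by shifting the moved term.
data _→βδγa_ : Term → Term → Set where
  β     : ∀ {M N} → app (lam M) N →βδγa (M [ N ])
  -- (λy.λx.M N) ▷ λx.(λy.M N)
  δ     : ∀ {M N} → app (lam (lam M)) N →βδγa lam (app (lam (rename swap01 M)) (shift N))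
  -- (λx.M N P) ▷ (λx.(M P) N)
  γ     : ∀ {M N P} → app (app (lam M) N) P →βδγa app (lam (app M (shift P))) N
  -- (M (λx.N P)) ▷ (λx.(M N) P)
  assoc : ∀ {M N P} → app M (app (lam N) P) →βδγa app (lam (app (shift M) N)) P
  ξlam  : ∀ {M M'} → M →βδγa M' → lam M →βδγa lam M'
  ξappl : ∀ {M M' N} → M →βδγa M' → app M N →βδγa app M' N
  ξappr : ∀ {M N N'} → N →βδγa N' → app M N →βδγa app M N'

data SN (R : Term → Term → Set) (t : Term) : Set where
  sn : (∀ {u} → R t u → SN R u) → SN R t

-- Split the reduction into β and the permutations π = δ, γ, assoc. A β-strongly normalising
-- term has an inductive normalisation derivation whose weight bounds the length of its
-- β-reductions: a redex (λu) v ts weighs one more than its contractum u[v] ts plus v.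
-- β-steps strictly decrease this weight. A permutation never increases it, since it only
-- moves a redex to where the same contraction and the same argument are paid for. The
-- permutations alone strictly decrease the multiplicative interpretation μ, so the pair
-- (weight, μ) decreases lexicographically along every step.
module Submission where

open import Defs
open import Data.Nat using (ℕ; zero; suc; _+_; _*_; _≤_; _<_; s≤s; z≤n; NonZero; >-nonZero)
open import Data.Nat.Properties
open import Data.Nat.Tactic.RingSolver using (solve-∀)
open import Data.Product using (∃-syntax; _×_; _,_)
open import Data.Sum using (_⊎_; inj₁; inj₂)
import Data.Sum as Sum
open import Data.Empty using (⊥-elim)
open import Function using (_∘_; id)
open import Relation.Binary.Construct.Union using (_∪_)
open import Relation.Binary.Construct.Closure.ReflexiveTransitive using (Star; ε; _◅_; _◅◅_; gmap)
open import Relation.Binary.PropositionalEquality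
  using (_≡_; _≢_; _≗_; refl; sym; trans; cong; cong₂; subst₂; module ≡-Reasoning)
import Relation.Binary.PropositionalEquality as Eq

liftR-cong : ∀ {ρ ρ'} → ρ ≗ ρ' → liftR ρ ≗ liftR ρ'
liftR-cong e zero    = refl
liftR-cong e (suc n) = cong suc (e n)

rename-cong : ∀ {ρ ρ'} → ρ ≗ ρ' → rename ρ ≗ rename ρ'
rename-cong e (var x)   = cong var (e x)
rename-cong e (lam t)   = cong lam (rename-cong (liftR-cong e) t)
rename-cong e (app t u) = cong₂ app (rename-cong e t) (rename-cong e u)

rename-∘ : ∀ ρ ρ' → rename ρ ∘ rename ρ' ≗ rename (ρ ∘ ρ')
rename-∘ ρ ρ' (var x)   = refl
rename-∘ ρ ρ' (lam t)   = cong lam (trans (rename-∘ (liftR ρ) (liftR ρ') t)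
  (rename-cong (λ { zero → refl ; (suc n) → refl }) t))
rename-∘ ρ ρ' (app t u) = cong₂ app (rename-∘ ρ ρ' t) (rename-∘ ρ ρ' u)

liftS-cong : ∀ {σ σ'} → σ ≗ σ' → liftS σ ≗ liftS σ'
liftS-cong e zero    = refl
liftS-cong e (suc n) = cong shift (e n)

subst-cong : ∀ {σ σ'} → σ ≗ σ' → subst σ ≗ subst σ'
subst-cong e (var x)   = e x
subst-cong e (lam t)   = cong lam (subst-cong (liftS-cong e) t)
subst-cong e (app t u) = cong₂ app (subst-cong e t) (subst-cong e u)

subst-rename : ∀ σ ρ → subst σ ∘ rename ρ ≗ subst (σ ∘ ρ)
subst-rename σ ρ (var x)   = refl
subst-rename σ ρ (lam t)   = cong lam (trans (subst-rename (liftS σ) (liftR ρ) t)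
  (subst-cong (λ { zero → refl ; (suc n) → refl }) t))
subst-rename σ ρ (app t u) = cong₂ app (subst-rename σ ρ t) (subst-rename σ ρ u)

rename-subst : ∀ ρ σ → rename ρ ∘ subst σ ≗ subst (rename ρ ∘ σ)
rename-subst ρ σ (var x)   = refl
rename-subst ρ σ (lam t)   = cong lam (trans (rename-subst (liftR ρ) (liftS σ) t)
  (subst-cong (λ { zero → refl
                 ; (suc n) → trans (rename-∘ (liftR ρ) suc (σ n)) (sym (rename-∘ suc ρ (σ n))) }) t))
rename-subst ρ σ (app t u) = cong₂ app (rename-subst ρ σ t) (rename-subst ρ σ u)

subst-subst : ∀ σ τ → subst σ ∘ subst τ ≗ subst (subst σ ∘ τ)
subst-subst σ τ (var x)   = refl
subst-subst σ τ (lam t)   = cong lam (trans (subst-subst (liftS σ) (liftS τ) t)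
  (subst-cong (λ { zero → refl
                 ; (suc n) → trans (subst-rename (liftS σ) suc (τ n))
                                   (sym (rename-subst suc σ (τ n))) }) t))
subst-subst σ τ (app t u) = cong₂ app (subst-subst σ τ t) (subst-subst σ τ u)

subst-var : subst var ≗ id
subst-var (var x)   = refl
subst-var (lam t)   = cong lam (trans (subst-cong (λ { zero → refl ; (suc n) → refl }) t) (subst-var t))
subst-var (app t u) = cong₂ app (subst-var t) (subst-var u)

rename-as-subst : ∀ ρ → rename ρ ≗ subst (var ∘ ρ)
rename-as-subst ρ (var x)   = refl
rename-as-subst ρ (lam t)   = cong lam (trans (rename-as-subst (liftR ρ) t)
  (subst-cong (λ { zero → refl ; (suc n) → refl }) t))
rename-as-subst ρ (app t u) = cong₂ app (rename-as-subst ρ t) (rename-as-subst ρ u)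

shift-[] : ∀ N P → shift P [ N ] ≡ P
shift-[] N P = trans (subst-rename (single N) suc P) (subst-var P)

subst-shift : ∀ σ N → subst (liftS σ) (shift N) ≡ shift (subst σ N)
subst-shift σ N = trans (subst-rename (liftS σ) suc N) (sym (rename-subst suc σ N))

rename-[] : ∀ ρ u v → rename ρ (u [ v ]) ≡ rename (liftR ρ) u [ rename ρ v ]
rename-[] ρ u v = trans (rename-subst ρ (single v) u)
  (sym (trans (subst-rename (single (rename ρ v)) (liftR ρ) u)
              (subst-cong (λ { zero → refl ; (suc n) → refl }) u)))

subst-[] : ∀ σ u v → subst σ (u [ v ]) ≡ subst (liftS σ) u [ subst σ v ]
subst-[] σ u v = trans (subst-subst σ (single v) u)
  (sym (trans (subst-subst (single (subst σ v)) (liftS σ) u)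
              (subst-cong (λ { zero → refl ; (suc n) → shift-[] (subst σ v) (σ n) }) u)))

subst-swap01 : ∀ σ M →
  subst (liftS (liftS σ)) (rename swap01 M) ≡ rename swap01 (subst (liftS (liftS σ)) M)
subst-swap01 σ M = trans (subst-rename _ swap01 M) (trans
  (subst-cong (λ { zero → refl
                 ; (suc zero) → refl
                 ; (suc (suc n)) → trans (rename-∘ suc suc (σ n))
                     (sym (trans (rename-∘ swap01 suc (shift (σ n))) (rename-∘ _ suc (σ n)))) }) M)
  (sym (rename-subst swap01 _ M)))

swap01-[shift] : ∀ w v → rename swap01 w [ shift v ] ≡ subst (liftS (single v)) w
swap01-[shift] w v = trans (subst-rename (single (shift v)) swap01 w)
  (subst-cong (λ { zero → refl ; (suc zero) → refl ; (suc (suc n)) → refl }) w)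

swap01-[]-[] : ∀ w v t →
  subst (liftS (single t)) (rename swap01 w) [ v ] ≡ subst (liftS (single v)) w [ t ]
swap01-[]-[] w v t = trans (subst-subst (single v) (liftS (single t)) (rename swap01 w))
  (trans (subst-rename _ swap01 w)
  (sym (trans (subst-subst (single t) (liftS (single v)) w)
              (subst-cong (λ { zero → sym (shift-[] v t)
                             ; (suc zero) → shift-[] t v
                             ; (suc (suc n)) → refl }) w))))

data _→π_ : Term → Term → Set where
  δ     : ∀ {M N} → app (lam (lam M)) N →π lam (app (lam (rename swap01 M)) (shift N))
  γ     : ∀ {M N P} → app (app (lam M) N) P →π app (lam (app M (shift P))) N
  assoc : ∀ {M N P} → app M (app (lam N) P) →π app (lam (app (shift M) N)) P
  ξlam  : ∀ {M M'} → M →π M' → lam M →π lam M'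
  ξappl : ∀ {M M' N} → M →π M' → app M N →π app M' N
  ξappr : ∀ {M N N'} → N →π N' → app M N →π app M N'

→βδγa⇒→β∪→π : ∀ {t u} → t →βδγa u → (_→β_ ∪ _→π_) t u
→βδγa⇒→β∪→π β         = inj₁ β
→βδγa⇒→β∪→π δ         = inj₂ δ
→βδγa⇒→β∪→π γ         = inj₂ γ
→βδγa⇒→β∪→π assoc     = inj₂ assoc
→βδγa⇒→β∪→π (ξlam s)  = Sum.map ξlam ξlam (→βδγa⇒→β∪→π s)
→βδγa⇒→β∪→π (ξappl s) = Sum.map ξappl ξappl (→βδγa⇒→β∪→π s)
→βδγa⇒→β∪→π (ξappr s) = Sum.map ξappr ξappr (→βδγa⇒→β∪→π s)

→β-subst : ∀ σ {t u} → t →β u → subst σ t →β subst σ u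
→β-subst σ (β {M} {N}) =
  Eq.subst (app (lam (subst (liftS σ) M)) (subst σ N) →β_) (sym (subst-[] σ M N)) β
→β-subst σ (ξlam s)    = ξlam (→β-subst (liftS σ) s)
→β-subst σ (ξappl s)   = ξappl (→β-subst σ s)
→β-subst σ (ξappr s)   = ξappr (→β-subst σ s)

→π-subst : ∀ σ {t u} → t →π u → subst σ t →π subst σ u
→π-subst σ (δ {M} {N}) = Eq.subst (subst σ (app (lam (lam M)) N) →π_)
  (cong₂ (λ a b → lam (app (lam a) b)) (sym (subst-swap01 σ M)) (sym (subst-shift σ N))) δ
→π-subst σ (γ {M} {N} {P}) = Eq.subst (subst σ (app (app (lam M) N) P) →π_)
  (cong (λ b → app (lam (app (subst (liftS σ) M) b)) (subst σ N)) (sym (subst-shift σ P))) γ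
→π-subst σ (assoc {M} {N} {P}) = Eq.subst (subst σ (app M (app (lam N) P)) →π_)
  (cong (λ b → app (lam (app b (subst (liftS σ) N))) (subst σ P)) (sym (subst-shift σ M))) assoc
→π-subst σ (ξlam s)  = ξlam (→π-subst (liftS σ) s)
→π-subst σ (ξappl s) = ξappl (→π-subst σ s)
→π-subst σ (ξappr s) = ξappr (→π-subst σ s)

→β-rename : ∀ ρ {t u} → t →β u → rename ρ t →β rename ρ u
→β-rename ρ {t} {u} s =
  subst₂ _→β_ (sym (rename-as-subst ρ t)) (sym (rename-as-subst ρ u)) (→β-subst (var ∘ ρ) s)

→π-rename : ∀ ρ {t u} → t →π u → rename ρ t →π rename ρ u
→π-rename ρ {t} {u} s =
  subst₂ _→π_ (sym (rename-as-subst ρ t)) (sym (rename-as-subst ρ u)) (→π-subst (var ∘ ρ) s)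

infixl 5 _▹_
infixr 5 _++_

data Args : Set where
  []  : Args
  _▹_ : Args → Term → Args

apps : Term → Args → Term
apps h []       = h
apps h (ts ▹ a) = app (apps h ts) a

_++_ : Args → Args → Args
ts ++ []       = ts
ts ++ (ss ▹ a) = (ts ++ ss) ▹ a

apps-++ : ∀ h ts ss → apps h (ts ++ ss) ≡ apps (apps h ts) ss
apps-++ h ts []       = refl
apps-++ h ts (ss ▹ a) = cong (λ z → app z a) (apps-++ h ts ss)

mapArgs : (Term → Term) → Args → Args
mapArgs f []       = []
mapArgs f (ts ▹ a) = mapArgs f ts ▹ f a

rename-apps : ∀ ρ h ts → rename ρ (apps h ts) ≡ apps (rename ρ h) (mapArgs (rename ρ) ts)
rename-apps ρ h []       = refl
rename-apps ρ h (ts ▹ a) = cong (λ z → app z (rename ρ a)) (rename-apps ρ h ts)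

[]-or-cons : (ts : Args) → ts ≡ [] ⊎ ∃[ t ] ∃[ ss ] ts ≡ ([] ▹ t) ++ ss
[]-or-cons []       = inj₁ refl
[]-or-cons (ts ▹ a) with []-or-cons ts
... | inj₁ refl          = inj₂ (a , [] , refl)
... | inj₂ (t , ss , refl) = inj₂ (t , ss ▹ a , refl)

app-injectiveˡ : ∀ {a b c d} → app a b ≡ app c d → a ≡ c
app-injectiveˡ refl = refl

apps-app≢lam : ∀ a b ts s → apps (app a b) ts ≢ lam s
apps-app≢lam a b []       s ()
apps-app≢lam a b (ts ▹ c) s ()

apps-var≢lam : ∀ x ts s → apps (var x) ts ≢ lam s
apps-var≢lam x []       s ()
apps-var≢lam x (ts ▹ c) s ()

apps-var≢redex : ∀ x ts u v ss → apps (var x) ts ≢ apps (app (lam u) v) ss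
apps-var≢redex x []       u v []       ()
apps-var≢redex x []       u v (ss ▹ c) ()
apps-var≢redex x (ts ▹ c) u v []       e = apps-var≢lam x ts u (app-injectiveˡ e)
apps-var≢redex x (ts ▹ c) u v (ss ▹ d) e = apps-var≢redex x ts u v ss (app-injectiveˡ e)

apps-redex-injective : ∀ {u v u' v'} ts ts' → apps (app (lam u) v) ts ≡ apps (app (lam u') v') ts' →
                       u ≡ u' × v ≡ v' × ts ≡ ts'
apps-redex-injective []       []        refl = refl , refl , refl
apps-redex-injective []       (ts' ▹ c) e    = ⊥-elim (apps-app≢lam _ _ ts' _ (sym (app-injectiveˡ e)))
apps-redex-injective (ts ▹ c) []        e    = ⊥-elim (apps-app≢lam _ _ ts _ (app-injectiveˡ e))
apps-redex-injective (ts ▹ c) (ts' ▹ d) e    with apps-redex-injective ts ts' (app-injectiveˡ e) | e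
... | refl , refl , refl | refl = refl , refl , refl

-- Root steps are given by equations so that they can be matched against spines apps h ts.
data β-Root (X a r : Term) : Set where
  β : ∀ {M} → X ≡ lam M → r ≡ M [ a ] → β-Root X a r

data π-Root (X a r : Term) : Set where
  δ     : ∀ {M} → X ≡ lam (lam M) → r ≡ lam (app (lam (rename swap01 M)) (shift a)) → π-Root X a r
  γ     : ∀ {M N} → X ≡ app (lam M) N → r ≡ app (lam (app M (shift a))) N → π-Root X a r
  assoc : ∀ {N P} → a ≡ app (lam N) P → r ≡ app (lam (app (shift X) N)) P → π-Root X a r

data AppStep (_⟶_ : Term → Term → Set) (Root : Term → Term → Term → Set) (X a t : Term) : Set where
  root  : Root X a t → AppStep _⟶_ Root X a t
  left  : ∀ {X'} → X ⟶ X' → t ≡ app X' a → AppStep _⟶_ Root X a t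
  right : ∀ {a'} → a ⟶ a' → t ≡ app X a' → AppStep _⟶_ Root X a t

→β-app-inv : ∀ {X a t} → app X a →β t → AppStep _→β_ β-Root X a t
→β-app-inv β         = root (β refl refl)
→β-app-inv (ξappl s) = left s refl
→β-app-inv (ξappr s) = right s refl

→π-app-inv : ∀ {X a t} → app X a →π t → AppStep _→π_ π-Root X a t
→π-app-inv δ         = root (δ refl refl)
→π-app-inv γ         = root (γ refl refl)
→π-app-inv assoc     = root (assoc refl refl)
→π-app-inv (ξappl s) = left s refl
→π-app-inv (ξappr s) = right s refl

module Compatible (_⟶_ : Term → Term → Set)
  (ξlam  : ∀ {M M'} → M ⟶ M' → lam M ⟶ lam M')
  (ξappl : ∀ {M M' N} → M ⟶ M' → app M N ⟶ app M' N)
  (ξappr : ∀ {M N N'} → N ⟶ N' → app M N ⟶ app M N')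
  (⟶-rename : ∀ ρ {M M'} → M ⟶ M' → rename ρ M ⟶ rename ρ M')
  {Root : Term → Term → Term → Set}
  (⟶-app-inv : ∀ {X a t} → app X a ⟶ t → AppStep _⟶_ Root X a t) where

  subst-⟶* : ∀ {σ τ} → (∀ n → Star _⟶_ (σ n) (τ n)) → ∀ t → Star _⟶_ (subst σ t) (subst τ t)
  subst-⟶* h (var x)   = h x
  subst-⟶* h (lam t)   =
    gmap lam ξlam (subst-⟶* (λ { zero → ε ; (suc n) → gmap shift (⟶-rename suc) (h n) }) t)
  subst-⟶* h (app t u) =
    gmap (λ z → app z _) ξappl (subst-⟶* h t) ◅◅ gmap (app _) ξappr (subst-⟶* h u)

  []-⟶* : ∀ u {v v'} → v ⟶ v' → Star _⟶_ (u [ v ]) (u [ v' ])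
  []-⟶* u s = subst-⟶* (λ { zero → s ◅ ε ; (suc n) → ε }) u

  data ArgsStep : Args → Args → Set where
    here  : ∀ {ts a a'} → a ⟶ a' → ArgsStep (ts ▹ a) (ts ▹ a')
    there : ∀ {ts ts' a} → ArgsStep ts ts' → ArgsStep (ts ▹ a) (ts' ▹ a)

  data SpineStep (h : Term) (ts : Args) (t : Term) : Set where
    head : ∀ {h'} → h ⟶ h' → t ≡ apps h' ts → SpineStep h ts t
    args : ∀ {ts'} → ArgsStep ts ts' → t ≡ apps h ts' → SpineStep h ts t
    root : ∀ {ts₁ a ss r} → ts ≡ (ts₁ ▹ a) ++ ss → Root (apps h ts₁) a r → t ≡ apps r ss →
           SpineStep h ts t

  spine-step : ∀ h ts {t} → apps h ts ⟶ t → SpineStep h ts t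
  spine-step h []       s = head s refl
  spine-step h (ts ▹ a) s with ⟶-app-inv s
  ... | root r      = root refl r refl
  ... | right s' eq = args (here s') eq
  ... | left s' eq  with spine-step h ts s'
  ...   | head r e    = head r (trans eq (cong (λ z → app z a) e))
  ...   | args as e   = args (there as) (trans eq (cong (λ z → app z a) e))
  ...   | root e r e' = root (cong (_▹ a) e) r (trans eq (cong (λ z → app z a) e'))

  apps-⟶ˡ : ∀ {h h'} ts → h ⟶ h' → apps h ts ⟶ apps h' ts
  apps-⟶ˡ []       s = s
  apps-⟶ˡ (ts ▹ a) s = ξappl (apps-⟶ˡ ts s)

  apps-⟶*ˡ : ∀ {h h'} ts → Star _⟶_ h h' → Star _⟶_ (apps h ts) (apps h' ts)
  apps-⟶*ˡ ts = gmap (λ z → apps z ts) (apps-⟶ˡ ts)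

  apps-⟶ʳ : ∀ {h ts ts'} → ArgsStep ts ts' → apps h ts ⟶ apps h ts'
  apps-⟶ʳ (here s)   = ξappr s
  apps-⟶ʳ (there as) = ξappl (apps-⟶ʳ as)

module β = Compatible _→β_ ξlam ξappl ξappr →β-rename →β-app-inv
module π = Compatible _→π_ ξlam ξappl ξappr →π-rename →π-app-inv

-- A redex pays separately for its argument, which its contraction may erase.
mutual
  data SNᵂs : Args → ℕ → Set where
    []  : SNᵂs [] 0
    _▹_ : ∀ {ts a n m} → SNᵂs ts n → SNᵂ a m → SNᵂs (ts ▹ a) (n + m)

  data SNᵂ : Term → ℕ → Set where
    lamᵂ   : ∀ {t n} → SNᵂ t n → SNᵂ (lam t) n
    neᵂ    : ∀ x {ts n} → SNᵂs ts n → SNᵂ (apps (var x) ts) n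
    redexᵂ : ∀ {u v ts m k} → SNᵂ (apps (u [ v ]) ts) m → SNᵂ v k →
             SNᵂ (apps (app (lam u) v) ts) (suc (m + k))

record Bounded {X : Set} (W : X → ℕ → Set) (_≺_ : ℕ → ℕ → Set) (x : X) (n : ℕ) : Set where
  constructor within
  field
    weight     : ℕ
    bound      : weight ≺ n
    derivation : W x weight

Bounded-map : ∀ {X Y : Set} {W : X → ℕ → Set} {V : Y → ℕ → Set} {_≺_ : ℕ → ℕ → Set} {x y n} →
              (∀ {m} → W x m → V y m) → Bounded W _≺_ x n → Bounded V _≺_ y n
Bounded-map f (within m m≺n d) = within m m≺n (f d)

SNᵂ-cast : ∀ {t t' n} → t ≡ t' → SNᵂ t n → SNᵂ t' n
SNᵂ-cast = Eq.subst (λ z → SNᵂ z _)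

SNᵂ-lam⁻¹ : ∀ {s n} → SNᵂ (lam s) n → SNᵂ s n
SNᵂ-lam⁻¹ d = inv d refl
  where
  inv : ∀ {t s n} → SNᵂ t n → t ≡ lam s → SNᵂ s n
  inv (lamᵂ d)               refl = d
  inv (neᵂ x {ts} _)         e    = ⊥-elim (apps-var≢lam x ts _ e)
  inv (redexᵂ {ts = ts} _ _) e    = ⊥-elim (apps-app≢lam _ _ ts _ e)

SNᵂ-redex⁻¹ : ∀ {u v ts n} → SNᵂ (apps (app (lam u) v) ts) n →
              ∃[ m ] ∃[ k ] SNᵂ (apps (u [ v ]) ts) m × SNᵂ v k × n ≡ suc (m + k)
SNᵂ-redex⁻¹ d = inv d refl
  where
  inv : ∀ {t u v ts n} → SNᵂ t n → t ≡ apps (app (lam u) v) ts →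
        ∃[ m ] ∃[ k ] SNᵂ (apps (u [ v ]) ts) m × SNᵂ v k × n ≡ suc (m + k)
  inv {ts = ts} (lamᵂ _)        e = ⊥-elim (apps-app≢lam _ _ ts _ (sym e))
  inv (neᵂ x {ts} _)            e = ⊥-elim (apps-var≢redex x ts _ _ _ e)
  inv (redexᵂ {ts = ts'} dc dv) e with apps-redex-injective ts' _ e
  ... | refl , refl , refl = _ , _ , dc , dv , refl

SNᵂs-++⁻¹ : ∀ ts ss {n} → SNᵂs (ts ++ ss) n → ∃[ n₁ ] ∃[ n₂ ] SNᵂs ts n₁ × SNᵂs ss n₂ × n ≡ n₁ + n₂
SNᵂs-++⁻¹ ts []       {n} d = n , 0 , d , [] , sym (+-identityʳ n)
SNᵂs-++⁻¹ ts (ss ▹ a) (_▹_ {m = m} d d') with SNᵂs-++⁻¹ ts ss d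
... | n₁ , n₂ , d₁ , d₂ , refl = n₁ , n₂ + m , d₁ , (d₂ ▹ d') , +-assoc n₁ n₂ m

SNᵂs-++ : ∀ {ts ss n₁ n₂} → SNᵂs ts n₁ → SNᵂs ss n₂ → SNᵂs (ts ++ ss) (n₁ + n₂)
SNᵂs-++ {n₁ = n₁} d₁ []                     = Eq.subst (SNᵂs _) (sym (+-identityʳ n₁)) d₁
SNᵂs-++ {n₁ = n₁} d₁ (_▹_ {n = n} {m} d₂ d) = Eq.subst (SNᵂs _) (+-assoc n₁ n m) (SNᵂs-++ d₁ d₂ ▹ d)

mutual
  SNᵂ-rename : ∀ ρ {t n} → SNᵂ t n → SNᵂ (rename ρ t) n
  SNᵂ-rename ρ (lamᵂ d)          = lamᵂ (SNᵂ-rename (liftR ρ) d)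
  SNᵂ-rename ρ (neᵂ x {ts} ds)   = SNᵂ-cast (sym (rename-apps ρ (var x) ts)) (neᵂ (ρ x) (SNᵂs-rename ρ ds))
  SNᵂ-rename ρ (redexᵂ {u} {v} {ts} dc dv) = SNᵂ-cast (sym (rename-apps ρ (app (lam u) v) ts))
    (redexᵂ (SNᵂ-cast (trans (rename-apps ρ (u [ v ]) ts)
                             (cong (λ z → apps z (mapArgs (rename ρ) ts)) (rename-[] ρ u v)))
                      (SNᵂ-rename ρ dc))
            (SNᵂ-rename ρ dv))

  SNᵂs-rename : ∀ ρ {ts n} → SNᵂs ts n → SNᵂs (mapArgs (rename ρ) ts) n
  SNᵂs-rename ρ []        = []
  SNᵂs-rename ρ (ds ▹ d)  = SNᵂs-rename ρ ds ▹ SNᵂ-rename ρ d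

-- The fuel k ≥ n only serves termination: the multi-step lemmas recurse on derivations that
-- are not structurally smaller.
mutual
  β-weight< : ∀ {k t n t'} → SNᵂ t n → n ≤ k → t →β t' → Bounded SNᵂ _<_ t' n
  β-weight< (lamᵂ d)                 n≤k (ξlam s) = Bounded-map lamᵂ (β-weight< d n≤k s)
  β-weight< (neᵂ x {ts} ds)          n≤k s = β-weight<-ne x ds n≤k (β.spine-step (var x) ts s)
  β-weight< (redexᵂ {ts = ts} dc dv) n≤k s = β-weight<-redex dc dv n≤k (β.spine-step _ ts s)

  β-weight<-ne : ∀ x {k ts n t'} → SNᵂs ts n → n ≤ k → β.SpineStep (var x) ts t' →
                 Bounded SNᵂ _<_ t' n
  β-weight<-ne x ds n≤k (β.head () _)
  β-weight<-ne x ds n≤k (β.args as refl)            = Bounded-map (neᵂ x) (β-weights< ds n≤k as)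
  β-weight<-ne x ds n≤k (β.root {ts₁} _ (β e _) _) = ⊥-elim (apps-var≢lam x ts₁ _ e)

  β-weight<-redex : ∀ {k u v ts m kv t'} → SNᵂ (apps (u [ v ]) ts) m → SNᵂ v kv → suc (m + kv) ≤ k →
                    β.SpineStep (app (lam u) v) ts t' → Bounded SNᵂ _<_ t' (suc (m + kv))
  β-weight<-redex dc dv n≤k (β.head s refl) = β-weight<-head dc dv n≤k (→β-app-inv s)
  β-weight<-redex {kv = kv} dc dv (s≤s m+kv≤k) (β.args as refl)
    with β-weight< dc (m+n≤o⇒m≤o _ m+kv≤k) (β.apps-⟶ʳ as)
  ... | within m' m'<m dc' = within _ (s≤s (+-monoˡ-< kv m'<m)) (redexᵂ dc' dv)
  β-weight<-redex dc dv n≤k (β.root {ts₁} _ (β e _) _) = ⊥-elim (apps-app≢lam _ _ ts₁ _ e)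

  β-weight<-head : ∀ {k u v ts m kv h'} → SNᵂ (apps (u [ v ]) ts) m → SNᵂ v kv → suc (m + kv) ≤ k →
                   AppStep _→β_ β-Root (lam u) v h' → Bounded SNᵂ _<_ (apps h' ts) (suc (m + kv))
  β-weight<-head {m = m} {kv} dc dv n≤k (root (β refl refl)) = within m (s≤s (m≤m+n m kv)) dc
  β-weight<-head {v = v} {ts} {kv = kv} dc dv (s≤s m+kv≤k) (left (ξlam us) refl)
    with β-weight< dc (m+n≤o⇒m≤o _ m+kv≤k) (β.apps-⟶ˡ ts (→β-subst (single v) us))
  ... | within m' m'<m dc' = within _ (s≤s (+-monoˡ-< kv m'<m)) (redexᵂ dc' dv)
  β-weight<-head {u = u} {ts = ts} dc dv (s≤s m+kv≤k) (right vs refl)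
    with β-weight< dv (m+n≤o⇒n≤o _ m+kv≤k) vs
       | β-weight≤* dc (m+n≤o⇒m≤o _ m+kv≤k) (β.apps-⟶*ˡ ts (β.[]-⟶* u vs))
  ... | within kv' kv'<kv dv' | within m' m'≤m dc' =
    within _ (s≤s (+-mono-≤-< m'≤m kv'<kv)) (redexᵂ dc' dv')

  β-weights< : ∀ {k ts n ts'} → SNᵂs ts n → n ≤ k → β.ArgsStep ts ts' → Bounded SNᵂs _<_ ts' n
  β-weights< (_▹_ {n = n} ds d) n+m≤k (β.here s) with β-weight< d (m+n≤o⇒n≤o n n+m≤k) s
  ... | within m' m'<m d' = within _ (+-monoʳ-< n m'<m) (ds ▹ d')
  β-weights< (_▹_ {n = n} {m} ds d) n+m≤k (β.there as) with β-weights< ds (m+n≤o⇒m≤o n n+m≤k) as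
  ... | within n' n'<n ds' = within _ (+-monoˡ-< m n'<n) (ds' ▹ d)

  β-weight≤* : ∀ {k t n t'} → SNᵂ t n → n ≤ k → Star _→β_ t t' → Bounded SNᵂ _≤_ t' n
  β-weight≤* d n≤k ε = within _ ≤-refl d
  β-weight≤* d n≤k (s ◅ ss) with β-weight< d n≤k s
  ... | within m m<n d' with β-weight≤* d' (≤-trans (<⇒≤ m<n) n≤k) ss
  ...   | within m' m'≤m d'' = within m' (≤-trans m'≤m (<⇒≤ m<n)) d''

apps-shift-[] : ∀ h ts N P ss → apps (app (shift (apps h ts)) N [ P ]) ss ≡ apps h ((ts ▹ N [ P ]) ++ ss)
apps-shift-[] h ts N P ss = begin
  apps (app (shift (apps h ts)) N [ P ]) ss
    ≡⟨ cong (λ z → apps (app z (N [ P ])) ss) (shift-[] P (apps h ts)) ⟩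
  apps (app (apps h ts) (N [ P ])) ss
    ≡⟨ sym (apps-++ h (ts ▹ N [ P ]) ss) ⟩
  apps h ((ts ▹ N [ P ]) ++ ss)
    ∎
  where open ≡-Reasoning

assoc-ne-weight : ∀ x ts N P ss {n} → SNᵂs ((ts ▹ app (lam N) P) ++ ss) n →
                  Bounded SNᵂ _≤_ (apps (app (lam (app (shift (apps (var x) ts)) N)) P) ss) n
assoc-ne-weight x ts N P ss ds with SNᵂs-++⁻¹ (ts ▹ app (lam N) P) ss ds
... | _ , n₂ , (_▹_ {n = n₁} ds₁ dR) , d₂ , refl with SNᵂ-redex⁻¹ {ts = []} dR
...   | c , e , dNP , dP , refl =
  within _ (≤-reflexive (reorder n₁ c e n₂))
    (redexᵂ (SNᵂ-cast (sym (apps-shift-[] (var x) ts N P ss)) (neᵂ x (SNᵂs-++ (ds₁ ▹ dNP) d₂))) dP)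
  where
  reorder : ∀ a c e b → suc (((a + c) + b) + e) ≡ (a + suc (c + e)) + b
  reorder = solve-∀

assoc-arg-weight : ∀ u N P ts {m k} → SNᵂ (apps (u [ app (lam N) P ]) ts) m → SNᵂ (app (lam N) P) k →
                   Bounded SNᵂ _≤_ (apps (app (lam (app (shift (lam u)) N)) P) ts) (suc (m + k))
assoc-arg-weight u N P ts {m} dc dv with SNᵂ-redex⁻¹ {ts = []} dv
                                       | β-weight≤* dc ≤-refl (β.apps-⟶*ˡ ts (β.[]-⟶* u β))
... | c , e , dNP , dP , refl | within m₂ m₂≤m dc₂ =
  within _ (bound m₂≤m)
    (redexᵂ (SNᵂ-cast (cong (λ z → apps (app z (N [ P ])) ts) (sym (shift-[] P (lam u))))
                      (redexᵂ dc₂ dNP))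
            dP)
  where
  reorder : ∀ m c e → suc (m + c) + e ≡ m + suc (c + e)
  reorder = solve-∀
  bound : m₂ ≤ m → suc (suc (m₂ + c) + e) ≤ suc (m + suc (c + e))
  bound m₂≤m = s≤s (≤-trans (+-monoˡ-≤ e (s≤s (+-monoˡ-≤ c m₂≤m))) (≤-reflexive (reorder m c e)))

assoc-spine-weight : ∀ u v ts N P ss {m k} →
  Bounded SNᵂ _≤_ (apps (app (lam (app (shift (apps (u [ v ]) ts)) N)) P) ss) m → SNᵂ v k →
  Bounded SNᵂ _≤_ (apps (app (lam (app (shift (apps (app (lam u) v) ts)) N)) P) ss) (suc (m + k))
assoc-spine-weight u v ts N P ss {k = k} (within m' m'≤m d) dv with SNᵂ-redex⁻¹ {ts = ss} d
... | c , e , dB , dP , refl =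
  within _ (s≤s (≤-trans (≤-reflexive (reorder c k e)) (+-monoˡ-≤ k m'≤m)))
    (redexᵂ (SNᵂ-cast (sym (apps-shift-[] (app (lam u) v) ts N P ss))
                      (redexᵂ (SNᵂ-cast (apps-shift-[] (u [ v ]) ts N P ss) dB) dv))
            dP)
  where
  reorder : ∀ c k e → suc (c + k) + e ≡ suc (c + e) + k
  reorder = solve-∀

γ-weight : ∀ u v a ss {m k} → SNᵂ (apps (u [ v ]) (([] ▹ a) ++ ss)) m → SNᵂ v k →
           SNᵂ (apps (app (lam (app u (shift a))) v) ss) (suc (m + k))
γ-weight u v a ss dc dv = redexᵂ (SNᵂ-cast contractum dc) dv
  where
  contractum : apps (u [ v ]) (([] ▹ a) ++ ss) ≡ apps (app (u [ v ]) (shift a [ v ])) ss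
  contractum = trans (apps-++ (u [ v ]) ([] ▹ a) ss)
                     (cong (λ z → apps (app (u [ v ]) z) ss) (sym (shift-[] v a)))

δ-weight : ∀ w v ts {m k} → SNᵂ (apps (lam (subst (liftS (single v)) w)) ts) m → SNᵂ v k →
           Bounded SNᵂ _≤_ (apps (lam (app (lam (rename swap01 w)) (shift v))) ts) (suc (m + k))
δ-weight w v ts dc dv with []-or-cons ts
... | inj₁ refl =
  within _ ≤-refl
    (lamᵂ (redexᵂ {ts = []} (SNᵂ-cast (sym (swap01-[shift] w v)) (SNᵂ-lam⁻¹ dc)) (SNᵂ-rename suc dv)))
... | inj₂ (t , ss , refl) with SNᵂ-redex⁻¹ (SNᵂ-cast (apps-++ _ ([] ▹ t) ss) dc)
...   | m₁ , k₁ , dW , dt , refl =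
  within _ (≤-reflexive (reorder m₁ _ k₁))
    (SNᵂ-cast (sym (apps-++ _ ([] ▹ t) ss))
      (redexᵂ (SNᵂ-cast (cong (λ z → apps (app (lam (subst (liftS (single t)) (rename swap01 w))) z) ss)
                              (sym (shift-[] t v)))
                        (redexᵂ (SNᵂ-cast (cong (λ z → apps z ss) (sym (swap01-[]-[] w v t))) dW) dv))
              dt))
  where
  reorder : ∀ m k k₁ → suc (suc (m + k) + k₁) ≡ suc (suc (m + k₁) + k)
  reorder = solve-∀

mutual
  π-weight≤ : ∀ {k t n t'} → SNᵂ t n → n ≤ k → t →π t' → Bounded SNᵂ _≤_ t' n
  π-weight≤ (lamᵂ d)               n≤k (ξlam s) = Bounded-map lamᵂ (π-weight≤ d n≤k s)
  π-weight≤ (neᵂ x {ts} ds)        n≤k s = π-weight≤-ne x ds n≤k (π.spine-step (var x) ts s)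
  π-weight≤ (redexᵂ {ts = ts} dc dv) n≤k s = π-weight≤-redex dc dv n≤k (π.spine-step _ ts s)

  π-weight≤-ne : ∀ x {k ts n t'} → SNᵂs ts n → n ≤ k → π.SpineStep (var x) ts t' → Bounded SNᵂ _≤_ t' n
  π-weight≤-ne x ds n≤k (π.head () _)
  π-weight≤-ne x ds n≤k (π.args as refl) = Bounded-map (neᵂ x) (π-weights≤ ds n≤k as)
  π-weight≤-ne x ds n≤k (π.root {ts₁} _ (δ e _) _) = ⊥-elim (apps-var≢lam x ts₁ _ e)
  π-weight≤-ne x ds n≤k (π.root {ts₁} _ (γ e _) _) = ⊥-elim (apps-var≢redex x ts₁ _ _ [] e)
  π-weight≤-ne x ds n≤k (π.root {ts₁} {ss = ss} refl (assoc refl refl) refl) =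
    assoc-ne-weight x ts₁ _ _ ss ds

  π-weight≤-redex : ∀ {k u v ts m kv t'} → SNᵂ (apps (u [ v ]) ts) m → SNᵂ v kv → suc (m + kv) ≤ k →
                    π.SpineStep (app (lam u) v) ts t' → Bounded SNᵂ _≤_ t' (suc (m + kv))
  π-weight≤-redex dc dv n≤k (π.head s refl) = π-weight≤-head dc dv n≤k (→π-app-inv s)
  π-weight≤-redex {kv = kv} dc dv (s≤s m+kv≤k) (π.args as refl)
    with π-weight≤ dc (m+n≤o⇒m≤o _ m+kv≤k) (π.apps-⟶ʳ as)
  ... | within m' m'≤m dc' = within _ (s≤s (+-monoˡ-≤ kv m'≤m)) (redexᵂ dc' dv)
  π-weight≤-redex dc dv n≤k (π.root {ts₁} _ (δ e _) _) = ⊥-elim (apps-app≢lam _ _ ts₁ _ e)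
  π-weight≤-redex {u = u} {v} dc dv n≤k (π.root {[]} {a} {ss} refl (γ refl refl) refl) =
    within _ ≤-refl (γ-weight u v a ss dc dv)
  π-weight≤-redex dc dv n≤k (π.root {ts₁ ▹ _} _ (γ e _) _) =
    ⊥-elim (apps-app≢lam _ _ ts₁ _ (app-injectiveˡ e))
  π-weight≤-redex {u = u} {v} dc dv (s≤s m+kv≤k)
                  (π.root {ts₁} {ss = ss} refl (assoc {N} {P} refl refl) refl) =
    assoc-spine-weight u v ts₁ N P ss
      (π-weight≤ dc (m+n≤o⇒m≤o _ m+kv≤k)
        (Eq.subst (_→π apps (app (lam (app (shift (apps (u [ v ]) ts₁)) N)) P) ss)
                  (sym (apps-++ (u [ v ]) (ts₁ ▹ app (lam N) P) ss))
                  (π.apps-⟶ˡ ss assoc)))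
      dv

  π-weight≤-head : ∀ {k u v ts m kv h'} → SNᵂ (apps (u [ v ]) ts) m → SNᵂ v kv → suc (m + kv) ≤ k →
                   AppStep _→π_ π-Root (lam u) v h' → Bounded SNᵂ _≤_ (apps h' ts) (suc (m + kv))
  π-weight≤-head {v = v} {ts} dc dv n≤k (root (δ refl refl)) = δ-weight _ v ts dc dv
  π-weight≤-head dc dv n≤k (root (γ () _))
  π-weight≤-head {u = u} {ts = ts} dc dv n≤k (root (assoc refl refl)) = assoc-arg-weight u _ _ ts dc dv
  π-weight≤-head {v = v} {ts} {kv = kv} dc dv (s≤s m+kv≤k) (left (ξlam us) refl)
    with π-weight≤ dc (m+n≤o⇒m≤o _ m+kv≤k) (π.apps-⟶ˡ ts (→π-subst (single v) us))
  ... | within m' m'≤m dc' = within _ (s≤s (+-monoˡ-≤ kv m'≤m)) (redexᵂ dc' dv)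
  π-weight≤-head {u = u} {ts = ts} dc dv (s≤s m+kv≤k) (right vs refl)
    with π-weight≤ dv (m+n≤o⇒n≤o _ m+kv≤k) vs
       | π-weight≤* dc (m+n≤o⇒m≤o _ m+kv≤k) (π.apps-⟶*ˡ ts (π.[]-⟶* u vs))
  ... | within kv' kv'≤kv dv' | within m' m'≤m dc' =
    within _ (s≤s (+-mono-≤ m'≤m kv'≤kv)) (redexᵂ dc' dv')

  π-weights≤ : ∀ {k ts n ts'} → SNᵂs ts n → n ≤ k → π.ArgsStep ts ts' → Bounded SNᵂs _≤_ ts' n
  π-weights≤ (_▹_ {n = n} ds d) n+m≤k (π.here s) with π-weight≤ d (m+n≤o⇒n≤o n n+m≤k) s
  ... | within m' m'≤m d' = within _ (+-monoʳ-≤ n m'≤m) (ds ▹ d')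
  π-weights≤ (_▹_ {n = n} {m} ds d) n+m≤k (π.there as) with π-weights≤ ds (m+n≤o⇒m≤o n n+m≤k) as
  ... | within n' n'≤n ds' = within _ (+-monoˡ-≤ m n'≤n) (ds' ▹ d)

  π-weight≤* : ∀ {k t n t'} → SNᵂ t n → n ≤ k → Star _→π_ t t' → Bounded SNᵂ _≤_ t' n
  π-weight≤* d n≤k ε = within _ ≤-refl d
  π-weight≤* d n≤k (s ◅ ss) with π-weight≤ d n≤k s
  ... | within m m≤n d' with π-weight≤* d' (≤-trans m≤n n≤k) ss
  ...   | within m' m'≤m d'' = within m' (≤-trans m'≤m m≤n) d''

data _▷_ : Term → Term → Set where
  appˡ : ∀ {a b} → app a b ▷ a
  appʳ : ∀ {a b} → app a b ▷ b
  lamᵇ : ∀ {a} → lam a ▷ a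

▷-→β : ∀ {t s s'} → t ▷ s → s →β s' → ∃[ t' ] t →β t' × t' ▷ s'
▷-→β appˡ s→s' = _ , ξappl s→s' , appˡ
▷-→β appʳ s→s' = _ , ξappr s→s' , appʳ
▷-→β lamᵇ s→s' = _ , ξlam s→s' , lamᵇ

▷*-→β : ∀ {t s s'} → Star _▷_ t s → s →β s' → ∃[ t' ] t →β t' × Star _▷_ t' s'
▷*-→β ε          s→s' = _ , s→s' , ε
▷*-→β (i ◅ t▷*s) s→s' with ▷*-→β t▷*s s→s'
... | _ , r , p with ▷-→β i r
...   | t' , t→t' , i' = t' , t→t' , i' ◅ p

-- Accessibility along →β ∪ ▷ lets SN⇒SNᵂ recurse both into β-reducts and into subterms.
mutual
  SN-▷* : ∀ {t} s → SN _→β_ t → Star _▷_ t s → SN (_→β_ ∪ _▷_) s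
  SN-▷* s h t▷*s = sn λ { (inj₁ s→s') → SN-▷*-→β h (▷*-→β t▷*s s→s')
                        ; (inj₂ s▷s') → SN-▷*-▷ h t▷*s s▷s' }

  SN-▷*-→β : ∀ {t s'} → SN _→β_ t → ∃[ t' ] t →β t' × Star _▷_ t' s' → SN (_→β_ ∪ _▷_) s'
  SN-▷*-→β (sn f) (_ , t→t' , t'▷*s') = SN-▷* _ (f t→t') t'▷*s'

  SN-▷*-▷ : ∀ {t s s'} → SN _→β_ t → Star _▷_ t s → s ▷ s' → SN (_→β_ ∪ _▷_) s'
  SN-▷*-▷ h t▷*s (appˡ {a}) = SN-▷* a h (t▷*s ◅◅ appˡ ◅ ε)
  SN-▷*-▷ h t▷*s (appʳ {b = b}) = SN-▷* b h (t▷*s ◅◅ appʳ ◅ ε)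
  SN-▷*-▷ h t▷*s (lamᵇ {a}) = SN-▷* a h (t▷*s ◅◅ lamᵇ ◅ ε)

data Shape : Term → Set where
  lam   : ∀ s → Shape (lam s)
  ne    : ∀ x ts → Shape (apps (var x) ts)
  redex : ∀ u v ts → Shape (apps (app (lam u) v) ts)

shape : ∀ t → Shape t
shape (var x)   = ne x []
shape (lam t)   = lam t
shape (app a b) with shape a
... | lam s       = redex s b []
... | ne x ts     = ne x (ts ▹ b)
... | redex u v ts = redex u v (ts ▹ b)

mutual
  SN⇒SNᵂ : ∀ t → SN (_→β_ ∪ _▷_) t → ∃[ n ] SNᵂ t n
  SN⇒SNᵂ t h with shape t
  SN⇒SNᵂ _ (sn f) | lam s with SN⇒SNᵂ s (f (inj₂ lamᵇ))
  ... | n , d = n , lamᵂ d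
  SN⇒SNᵂ _ h      | ne x ts with SN⇒SNᵂs (var x) ts h
  ... | n , ds = n , neᵂ x ds
  SN⇒SNᵂ _ (sn f) | redex u v ts
    with SN⇒SNᵂ _ (f (inj₁ (β.apps-⟶ˡ ts β))) | SN⇒SNᵂ-redex-arg u v ts (sn f)
  ... | m , dc | k , dv = _ , redexᵂ dc dv

  SN⇒SNᵂs : ∀ h ts → SN (_→β_ ∪ _▷_) (apps h ts) → ∃[ n ] SNᵂs ts n
  SN⇒SNᵂs h []       _      = 0 , []
  SN⇒SNᵂs h (ts ▹ b) (sn f) with SN⇒SNᵂs h ts (f (inj₂ appˡ)) | SN⇒SNᵂ b (f (inj₂ appʳ))
  ... | n , ds | m , d = _ , (ds ▹ d)

  SN⇒SNᵂ-redex-arg : ∀ u v ts → SN (_→β_ ∪ _▷_) (apps (app (lam u) v) ts) → ∃[ n ] SNᵂ v n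
  SN⇒SNᵂ-redex-arg u v []       (sn f) = SN⇒SNᵂ v (f (inj₂ appʳ))
  SN⇒SNᵂ-redex-arg u v (ts ▹ b) (sn f) = SN⇒SNᵂ-redex-arg u v ts (f (inj₂ appˡ))

-- Variables count 2 rather than 1: δ decreases μ only when its argument has size at least 2.
μ : Term → ℕ
μ (var x)   = 2
μ (lam t)   = suc (μ t)
μ (app a b) = μ a * μ b

mutual
  μ≥2 : ∀ t → 2 ≤ μ t
  μ≥2 (var x)   = ≤-refl
  μ≥2 (lam t)   = m≤n⇒m≤1+n (μ≥2 t)
  μ≥2 (app a b) = ≤-trans (μ≥2 a) (m≤m*n (μ a) (μ b) {{μ-nonZero b}})

  μ-nonZero : ∀ t → NonZero (μ t)
  μ-nonZero t = >-nonZero (≤-trans (s≤s z≤n) (μ≥2 t))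

μ-rename : ∀ ρ t → μ (rename ρ t) ≡ μ t
μ-rename ρ (var x)   = refl
μ-rename ρ (lam t)   = cong suc (μ-rename (liftR ρ) t)
μ-rename ρ (app a b) = cong₂ _*_ (μ-rename ρ a) (μ-rename ρ b)

δ-μ : ∀ M N → 2 ≤ N → suc (suc M * N) < suc (suc M) * N
δ-μ M N 2≤N = +-monoˡ-≤ (suc M * N) 2≤N

γ-μ : ∀ M N P → .{{NonZero N}} → 2 ≤ P → suc (M * P) * N < (suc M * N) * P
γ-μ M N P 2≤P = begin-strict
  suc (M * P) * N        ≡⟨ expand M N P ⟩
  N * 1 + M * P * N      <⟨ +-monoˡ-< (M * P * N) (*-monoʳ-< N 2≤P) ⟩
  N * P + M * P * N      ≡⟨ collect M N P ⟩
  (suc M * N) * P        ∎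
  where
  open ≤-Reasoning
  expand : ∀ M N P → suc (M * P) * N ≡ N * 1 + M * P * N
  expand = solve-∀
  collect : ∀ M N P → N * P + M * P * N ≡ (suc M * N) * P
  collect = solve-∀

assoc-μ : ∀ M N P → .{{NonZero P}} → 2 ≤ M → suc (M * N) * P < M * (suc N * P)
assoc-μ M N P 2≤M = begin-strict
  suc (M * N) * P        ≡⟨ expand M N P ⟩
  1 * P + M * N * P      <⟨ +-monoˡ-< (M * N * P) (*-monoˡ-< P 2≤M) ⟩
  M * P + M * N * P      ≡⟨ collect M N P ⟩
  M * (suc N * P)        ∎
  where
  open ≤-Reasoning
  expand : ∀ M N P → suc (M * N) * P ≡ 1 * P + M * N * P
  expand = solve-∀
  collect : ∀ M N P → M * P + M * N * P ≡ M * (suc N * P)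
  collect = solve-∀

→π-μ : ∀ {t u} → t →π u → μ u < μ t
→π-μ (δ {M} {N}) rewrite μ-rename swap01 M | μ-rename suc N = δ-μ (μ M) (μ N) (μ≥2 N)
→π-μ (γ {M} {N} {P}) rewrite μ-rename suc P = γ-μ (μ M) (μ N) (μ P) {{μ-nonZero N}} (μ≥2 P)
→π-μ (assoc {M} {N} {P}) rewrite μ-rename suc M = assoc-μ (μ M) (μ N) (μ P) {{μ-nonZero P}} (μ≥2 M)
→π-μ (ξlam s)            = s≤s (→π-μ s)
→π-μ (ξappl {N = N} s)   = *-monoˡ-< (μ N) {{μ-nonZero N}} (→π-μ s)
→π-μ (ξappr {M = M} s)   = *-monoʳ-< (μ M) {{μ-nonZero M}} (→π-μ s)

module Lexicographic {_⟶_ _⟶₁_ _⟶₂_ : Term → Term → Set}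
  (W : Term → ℕ → Set) (measure : Term → ℕ)
  (⟶-split  : ∀ {t u} → t ⟶ u → (_⟶₁_ ∪ _⟶₂_) t u)
  (⟶₁-weight : ∀ {t n u} → W t n → t ⟶₁ u → Bounded W _<_ u n)
  (⟶₂-weight : ∀ {t n u} → W t n → t ⟶₂ u → Bounded W _≤_ u n)
  (⟶₂-measure : ∀ {t u} → t ⟶₂ u → measure u < measure t) where

  mutual
    SN-bounded : ∀ k j {t n} → W t n → n < k → measure t < j → SN _⟶_ t
    SN-bounded k j d n<k t<j = sn (λ s → SN-step k j d n<k t<j (⟶-split s))

    SN-step : ∀ k j {t n u} → W t n → n < k → measure t < j → (_⟶₁_ ∪ _⟶₂_) t u → SN _⟶_ u
    SN-step (suc k) (suc j) d (s≤s n≤k) _ (inj₁ s) =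
      let within _ m<n d' = ⟶₁-weight d s in SN-bounded k _ d' (<-≤-trans m<n n≤k) ≤-refl
    SN-step (suc k) (suc j) d n<k (s≤s t≤j) (inj₂ s) =
      let within _ m≤n d' = ⟶₂-weight d s
      in SN-bounded (suc k) j d' (≤-<-trans m≤n n<k) (<-≤-trans (⟶₂-measure s) t≤j)

  SN-lex : ∀ {t n} → W t n → SN _⟶_ t
  SN-lex d = SN-bounded _ _ d ≤-refl ≤-refl

open Lexicographic SNᵂ μ →βδγa⇒→β∪→π (λ d → β-weight< d ≤-refl) (λ d → π-weight≤ d ≤-refl) →π-μ
  using (SN-lex)

theorem1 : (t : Term) → SN _→β_ t → SN _→βδγa_ t
theorem1 t h with SN⇒SNᵂ t (SN-▷* t h ε)
... | n , d = SN-lex d
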